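{- Let $T$ be a string of length $n$ and $1 < i \le j \le n$. For each $[s,t] \in \mathsf{MUS}(T[i-1..j])$ with $s \ne i-1$, if $[s,t] \notin \mathsf{MUS}(T[i..j])$ then $\#\mathit{occ}_{T[i-1..j]}(\mathit{sqp}_{i-1,j}) = 2$ and $\mathit{sqp}_{i-1,j}$ is a proper substring of $T[s..t]$.
   Context: For a string $W$, $W[a..b]$ is the substring from position $a$ to position $b$ (empty if $a>b$). For strings $w,W$, $\#\mathit{occ}_W(w)$ is the number of positions at which $w$ occurs in $W$, with $\#\mathit{occ}_W(\varepsilon)=|W|+1$. A substring $w$ of $W$ is unique in $W$ if $\#\mathit{occ}_W(w)=1$, repeating if $\#\mathit{occ}_W(w)\ge 2$, quasi-unique if $1\le\#\mathit{occ}_W(w)\le 2$. For $1\le a\le b\le n$, $\mathsf{MUS}(T[a..b])$ is the set of intervals $[s,t]$ with $a\le s\le t\le b$ (positions refer to $T$) such that $T[s..t]$ is unique in $T[a..b]$ and both $T[s+1..t]$ and $T[s..t-1]$ are repeating in $T[a..b]$. $\mathit{sqp}_{a,b}$ is the shortest non-empty prefix of $T[a..b]$ that is quasi-unique in $T[a..b]$. -}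

module Defs where

open import Data.Nat using (ℕ; zero; suc; _+_; _∸_; _≤_; _<_; _≥_; _≤ᵇ_)
open import Data.Bool using (Bool; true; false; _∧_)
open import Data.List using (List; []; _∷_; upTo)
open import Data.Vec using (Vec; toList)
open import Data.Maybe using (Maybe; just; nothing)
open import Data.Product using (_×_; ∃)
open import Relation.Nullary.Decidable using (⌊_⌋)
open import Relation.Nullary using (¬_)
open import Relation.Binary.Definitions using (DecidableEquality)
open import Relation.Binary.PropositionalEquality using (_≡_)

-- Strings are vectors over an alphabet A with decidable equality.
-- Positions are 1-based: T[p] for 1 ≤ p ≤ n; out of range gives nothing.

nth : {A : Set} → List A → ℕ → Maybe A
nth []       _       = nothing
nth (x ∷ xs) zero    = just x
nth (x ∷ xs) (suc k) = nth xs k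

at : {A : Set} {n : ℕ} → Vec A n → ℕ → Maybe A
at T zero    = nothing
at T (suc p) = nth (toList T) p

eqM : {A : Set} → DecidableEquality A → Maybe A → Maybe A → Bool
eqM _≟_ (just x) (just y) = ⌊ x ≟ y ⌋
eqM _≟_ nothing  nothing  = true
eqM _≟_ _        _        = false

-- length of the interval [s,t] (0 if s > t)
len : ℕ → ℕ → ℕ
len s t = suc t ∸ s

allᵇ : (ℕ → Bool) → List ℕ → Bool
allᵇ f []       = true
allᵇ f (x ∷ xs) = f x ∧ allᵇ f xs

matches : {A : Set} {n : ℕ} → DecidableEquality A → Vec A n → ℕ → ℕ → ℕ → Bool
matches _≟_ T p q L = allᵇ (λ k → eqM _≟_ (at T (p + k)) (at T (q + k))) (upTo L)

-- #occ_{T[a..b]}(T[s..t]): number of positions p with a ≤ p and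
-- p + |T[s..t]| - 1 ≤ b such that T[s..t] occurs at p.
-- For the empty string (s > t) this is |T[a..b]| + 1.
countᵇ : (ℕ → Bool) → List ℕ → ℕ
countᵇ f []       = 0
countᵇ f (x ∷ xs) with f x
... | true  = suc (countᵇ f xs)
... | false = countᵇ f xs

occ : {A : Set} {n : ℕ} → DecidableEquality A → Vec A n → ℕ → ℕ → ℕ → ℕ → ℕ
occ _≟_ T a b s t =
  countᵇ (λ p → (a ≤ᵇ p) ∧ ((p + len s t) ≤ᵇ suc b) ∧ matches _≟_ T p s (len s t))
         (upTo (suc (suc b)))

InMUS : {A : Set} {n : ℕ} → DecidableEquality A → Vec A n → ℕ → ℕ → ℕ → ℕ → Set
InMUS _≟_ T a b s t =
  a ≤ s × s ≤ t × t ≤ b ×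
  occ _≟_ T a b s t ≡ 1 ×
  occ _≟_ T a b (suc s) t ≥ 2 ×
  occ _≟_ T a b s (t ∸ 1) ≥ 2

QuasiUnique : {A : Set} {n : ℕ} → DecidableEquality A → Vec A n → ℕ → ℕ → ℕ → ℕ → Set
QuasiUnique _≟_ T a b s t = 1 ≤ occ _≟_ T a b s t × occ _≟_ T a b s t ≤ 2

-- sqp_{a,b} = T[a..e]: the shortest non-empty prefix of T[a..b]
-- that is quasi-unique in T[a..b]
IsSqp : {A : Set} {n : ℕ} → DecidableEquality A → Vec A n → ℕ → ℕ → ℕ → Set
IsSqp _≟_ T a b e =
  a ≤ e × e ≤ b × QuasiUnique _≟_ T a b a e ×
  (∀ e′ → a ≤ e′ → e′ < e → ¬ QuasiUnique _≟_ T a b a e′)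

ProperSubstring : {A : Set} {n : ℕ} → DecidableEquality A → Vec A n → ℕ → ℕ → ℕ → ℕ → Set
ProperSubstring _≟_ T u v s t = 1 ≤ occ _≟_ T s t u v × len u v < len s t

-- Since T[s..t] is a minimal unique substring of T[i-1..j] starting inside T[i..j], it stays
-- unique in T[i..j]; as it is no MUS there, one of its two maximal proper substrings w repeats in
-- T[i-1..j] but not in T[i..j]. Then w must occur at position i-1, with exactly two occurrences,
-- so it is a quasi-unique prefix of T[i-1..j]. The shortest such prefix sqp is a prefix of w, has
-- at least as many occurrences as w, hence exactly two, and occurs inside T[s..t] wherever w does.
module Submission where

open import Defs
open import Data.Nat
  using (ℕ; suc; pred; _+_; _∸_; _≤_; _<_; z≤n; s≤s; _≤ᵇ_; _≤?_; NonZero; ≢-nonZero)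
open import Data.Nat.Properties
open import Data.Bool using (Bool; true; false; _∧_; T)
open import Data.Bool.Properties using (T-∧)
open import Data.Unit using (tt)
open import Data.List using ([]; _∷_; upTo)
open import Data.List.Membership.Propositional using (_∈_)
open import Data.List.Membership.Propositional.Properties using (∈-upTo⁺; ∈-upTo⁻)
open import Data.List.Relation.Unary.Any using (here; there)
open import Data.List.Relation.Unary.All using (lookup)
open import Data.List.Relation.Unary.AllPairs using (_∷_)
open import Data.List.Relation.Unary.Unique.Propositional using (Unique)
open import Data.List.Relation.Unary.Unique.Propositional.Properties using (upTo⁺)
open import Data.Vec using (Vec)
open import Data.Maybe using (just; nothing)
open import Data.Product using (_×_; _,_; proj₁; proj₂)
open import Data.Sum using (_⊎_; inj₁; inj₂; [_,_]′)
open import Data.Empty using (⊥-elim)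
open import Function using (_∘_; id)
open import Function.Bundles using (Equivalence)
open import Relation.Nullary using (¬_; yes; no)
open import Relation.Nullary.Decidable using (T?; toWitness; fromWitness)
open import Relation.Binary.Definitions using (DecidableEquality)
open import Relation.Binary.PropositionalEquality
  using (_≡_; _≢_; refl; sym; trans; cong; subst; module ≡-Reasoning)

open Equivalence using (to; from)

countᵇ-∷ : ∀ (f : ℕ → Bool) z xs → countᵇ f xs ≤ countᵇ f (z ∷ xs)
countᵇ-∷ f z xs with f z
... | true  = n≤1+n _
... | false = ≤-refl

countᵇ-hit : ∀ f {z} xs → T (f z) → countᵇ f (z ∷ xs) ≡ suc (countᵇ f xs)
countᵇ-hit f {z} xs fz with f z
... | true  = refl
... | false = ⊥-elim fz

countᵇ-mono : ∀ {f g} xs → (∀ {p} → p ∈ xs → T (f p) → T (g p)) → countᵇ f xs ≤ countᵇ g xs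
countᵇ-mono [] _ = z≤n
countᵇ-mono {f} {g} (x ∷ xs) f⇒g with f x | g x | f⇒g (here refl)
... | true  | true  | _      = s≤s (countᵇ-mono xs (f⇒g ∘ there))
... | true  | false | fx⇒gx = ⊥-elim (fx⇒gx tt)
... | false | true  | _      = m≤n⇒m≤1+n (countᵇ-mono xs (f⇒g ∘ there))
... | false | false | _      = countᵇ-mono xs (f⇒g ∘ there)

countᵇ-≥1 : ∀ {f x} xs → x ∈ xs → T (f x) → 1 ≤ countᵇ f xs
countᵇ-≥1 {f} (_ ∷ xs) (here refl) fx = subst (1 ≤_) (sym (countᵇ-hit f xs fx)) (s≤s z≤n)
countᵇ-≥1 {f} (z ∷ xs) (there x∈) fx = ≤-trans (countᵇ-≥1 xs x∈ fx) (countᵇ-∷ f z xs)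

countᵇ-≥2 : ∀ {f x y} xs → x ∈ xs → y ∈ xs → x ≢ y → T (f x) → T (f y) → 2 ≤ countᵇ f xs
countᵇ-≥2 (_ ∷ xs) (here refl) (here refl) x≢y _ _ = ⊥-elim (x≢y refl)
countᵇ-≥2 {f} (_ ∷ xs) (here refl) (there y∈) _ fx fy =
  subst (2 ≤_) (sym (countᵇ-hit f xs fx)) (s≤s (countᵇ-≥1 xs y∈ fy))
countᵇ-≥2 {f} (_ ∷ xs) (there x∈) (here refl) _ fx fy =
  subst (2 ≤_) (sym (countᵇ-hit f xs fy)) (s≤s (countᵇ-≥1 xs x∈ fx))
countᵇ-≥2 {f} (z ∷ xs) (there x∈) (there y∈) x≢y fx fy =
  ≤-trans (countᵇ-≥2 xs x∈ y∈ x≢y fx fy) (countᵇ-∷ f z xs)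

countᵇ-≤-suc : ∀ {f g a} xs → Unique xs → (∀ {p} → T (f p) → T (g p) ⊎ p ≡ a) →
               countᵇ f xs ≤ suc (countᵇ g xs)
countᵇ-≤-suc [] _ _ = z≤n
countᵇ-≤-suc {f} {g} (x ∷ xs) (x∉xs ∷ unique) f⇒g⊎a with f x | f⇒g⊎a {x}
... | false | _ = ≤-trans (countᵇ-≤-suc xs unique f⇒g⊎a) (s≤s (countᵇ-∷ g x xs))
... | true  | fx⇒ with fx⇒ tt
...   | inj₁ gx   = s≤s (subst (_ ≤_) (sym (countᵇ-hit g xs gx)) (countᵇ-≤-suc xs unique f⇒g⊎a))
...   | inj₂ refl = s≤s (≤-trans (countᵇ-mono xs f⇒g) (countᵇ-∷ g x xs))
  where
    f⇒g : ∀ {p} → p ∈ xs → T (f p) → T (g p)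
    f⇒g p∈ fp = [ id , (λ p≡x → ⊥-elim (lookup x∉xs p∈ (sym p≡x))) ]′ (f⇒g⊎a fp)

countᵇ-gain : ∀ {f g a} xs → (∀ {p} → T (f p) → T (g p) ⊎ p ≡ a) →
              countᵇ g xs < countᵇ f xs → T (f a)
countᵇ-gain {f} {g} {a} xs f⇒g⊎a g<f with T? (f a)
... | yes fa = fa
... | no ¬fa = ⊥-elim (<⇒≱ g<f (countᵇ-mono xs f⇒g))
  where
    f⇒g : ∀ {p} → p ∈ xs → T (f p) → T (g p)
    f⇒g _ fp = [ id , (λ { refl → ⊥-elim (¬fa fp) }) ]′ (f⇒g⊎a fp)

allᵇ⁺ : ∀ {f} xs → (∀ {x} → x ∈ xs → T (f x)) → T (allᵇ f xs)
allᵇ⁺ []       _  = tt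
allᵇ⁺ (x ∷ xs) fs = from T-∧ (fs (here refl) , allᵇ⁺ xs (fs ∘ there))

allᵇ⁻ : ∀ {f x} xs → T (allᵇ f xs) → x ∈ xs → T (f x)
allᵇ⁻ (_ ∷ _)  fs (here refl) = proj₁ (to T-∧ fs)
allᵇ⁻ (_ ∷ xs) fs (there x∈)  = allᵇ⁻ xs (proj₂ (to T-∧ fs)) x∈

+-len : ∀ {s t} → s ≤ suc t → s + len s t ≡ suc t
+-len = m+[n∸m]≡n

len-pred : ∀ a L .{{_ : NonZero L}} → len a (a + pred L) ≡ L
len-pred a L = begin
  suc (a + pred L) ∸ a    ≡⟨ +-∸-assoc 1 (m≤m+n a (pred L)) ⟩
  suc (a + pred L ∸ a)    ≡⟨ cong suc (m+n∸m≡n a (pred L)) ⟩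
  suc (pred L)            ≡⟨ suc-pred L ⟩
  L                       ∎
  where open ≡-Reasoning

ProperSubinterval : ℕ → ℕ → ℕ → ℕ → Set
ProperSubinterval u v s t = s ≤ u × u + len u v ≤ suc t × len u v < len s t

dropFirst-proper : ∀ {s t} → s ≤ t → ProperSubinterval (suc s) t s t
dropFirst-proper {s} s≤t =
  n≤1+n s , ≤-reflexive (+-len (s≤s s≤t)) , ≤-reflexive (sym (+-∸-assoc 1 s≤t))

dropLast-proper : ∀ {s t} → 1 ≤ t → s ≤ t → ProperSubinterval s (t ∸ 1) s t
dropLast-proper {t = suc t} _ s≤t =
  ≤-refl , ≤-trans (≤-reflexive (+-len s≤t)) (n≤1+n _) , ∸-monoˡ-< ≤-refl s≤t

module Text {A : Set} (_≟_ : DecidableEquality A) {n : ℕ} (W : Vec A n) where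

  #occ : ℕ → ℕ → ℕ → ℕ → ℕ
  #occ = occ _≟_ W

  eqM-refl : ∀ x → T (eqM _≟_ x x)
  eqM-refl nothing  = tt
  eqM-refl (just x) = fromWitness {a? = x ≟ x} refl

  eqM⇒≡ : ∀ x y → T (eqM _≟_ x y) → x ≡ y
  eqM⇒≡ nothing  nothing  _  = refl
  eqM⇒≡ (just x) (just y) x≡y = cong just (toWitness x≡y)

  SameFactor : ℕ → ℕ → ℕ → Set
  SameFactor p q L = ∀ {m} → m < L → at W (p + m) ≡ at W (q + m)

  matches⇒SameFactor : ∀ {p q L} → T (matches _≟_ W p q L) → SameFactor p q L
  matches⇒SameFactor {p} {q} agree m<L =
    eqM⇒≡ (at W (p + _)) (at W (q + _)) (allᵇ⁻ _ agree (∈-upTo⁺ m<L))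

  SameFactor⇒matches : ∀ {p q L} → SameFactor p q L → T (matches _≟_ W p q L)
  SameFactor⇒matches {p} {q} same = allᵇ⁺ _ λ {m} m∈ →
    subst (λ y → T (eqM _≟_ (at W (p + m)) y)) (same (∈-upTo⁻ m∈)) (eqM-refl (at W (p + m)))

  occursᵇ : ℕ → ℕ → ℕ → ℕ → ℕ → Bool
  occursᵇ a b s t p = (a ≤ᵇ p) ∧ ((p + len s t) ≤ᵇ suc b) ∧ matches _≟_ W p s (len s t)

  record Occurs (a b s t p : ℕ) : Set where
    constructor occurs
    field
      start : a ≤ p
      fits  : p + len s t ≤ suc b
      same  : SameFactor p s (len s t)

  occursᵇ⇒Occurs : ∀ {a b s t p} → T (occursᵇ a b s t p) → Occurs a b s t p
  occursᵇ⇒Occurs {a} {b} {s} {t} {p} h =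
    let (a≤p , rest) = to T-∧ h
        (fits , agree) = to T-∧ rest
    in occurs (≤ᵇ⇒≤ a p a≤p) (≤ᵇ⇒≤ (p + len s t) (suc b) fits) (matches⇒SameFactor {p} {s} agree)

  Occurs⇒occursᵇ : ∀ {a b s t p} → Occurs a b s t p → T (occursᵇ a b s t p)
  Occurs⇒occursᵇ {s = s} {t} {p} (occurs a≤p fits same) =
    from T-∧ (≤⇒≤ᵇ a≤p , from T-∧ (≤⇒≤ᵇ fits , SameFactor⇒matches {p} {s} {len s t} same))

  Occurs⇒∈ : ∀ {a b s t p} → Occurs a b s t p → p ∈ upTo (suc (suc b))
  Occurs⇒∈ {s = s} {t} {p} (occurs _ fits _) = ∈-upTo⁺ (s≤s (≤-trans (m≤m+n p (len s t)) fits))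

  Occurs-self : ∀ {a b s t} → a ≤ s → s ≤ suc t → t ≤ b → Occurs a b s t s
  Occurs-self a≤s s≤t+1 t≤b =
    occurs a≤s (≤-trans (≤-reflexive (+-len s≤t+1)) (s≤s t≤b)) (λ _ → refl)

  occursᵇ-narrow : ∀ {a b s t p} → T (occursᵇ a b s t p) → T (occursᵇ (suc a) b s t p) ⊎ p ≡ a
  occursᵇ-narrow {a} {b} {s} {t} h with occursᵇ⇒Occurs {a} {b} {s} {t} h
  ... | occurs a≤p fits same with m≤n⇒m<n∨m≡n a≤p
  ...   | inj₁ a<p = inj₁ (Occurs⇒occursᵇ {suc a} {b} {s} {t} (occurs a<p fits same))
  ...   | inj₂ a≡p = inj₂ (sym a≡p)

  occ-≥1 : ∀ {a b s t p} → Occurs a b s t p → 1 ≤ #occ a b s t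
  occ-≥1 {a} {b} {s} {t} o =
    countᵇ-≥1 {f = occursᵇ a b s t} _ (Occurs⇒∈ o) (Occurs⇒occursᵇ o)

  occ-≥2 : ∀ {a b s t p q} → Occurs a b s t p → Occurs a b s t q → p ≢ q → 2 ≤ #occ a b s t
  occ-≥2 {a} {b} {s} {t} o o′ p≢q = countᵇ-≥2 {f = occursᵇ a b s t} _
    (Occurs⇒∈ o) (Occurs⇒∈ o′) p≢q (Occurs⇒occursᵇ o) (Occurs⇒occursᵇ o′)

  occ-mono : ∀ {a a′ b s s′ t t′} → (∀ {p} → Occurs a b s t p → Occurs a′ b s′ t′ p) →
             #occ a b s t ≤ #occ a′ b s′ t′
  occ-mono {a} {a′} {b} {s} {s′} {t} {t′} o⇒o′ =
    countᵇ-mono {f = occursᵇ a b s t} {g = occursᵇ a′ b s′ t′} _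
      (λ _ → Occurs⇒occursᵇ ∘ o⇒o′ ∘ occursᵇ⇒Occurs)

  occ-narrow : ∀ a b s t → #occ (suc a) b s t ≤ #occ a b s t
  occ-narrow a b s t = occ-mono {suc a} {a} {b} {s} {s} {t} {t}
    λ (occurs a<p fits same) → occurs (<⇒≤ a<p) fits same

  occ-prefix : ∀ a b s t t′ → len s t′ ≤ len s t → #occ a b s t ≤ #occ a b s t′
  occ-prefix a b s t t′ shorter = occ-mono {a} {a} {b} {s} {s} {t} {t′}
    λ {p} (occurs a≤p fits same) →
      occurs a≤p (≤-trans (+-monoʳ-≤ p shorter) fits) (λ m< → same (<-≤-trans m< shorter))

  occ-cong : ∀ a b s t s′ t′ → len s t ≡ len s′ t′ → SameFactor s s′ (len s t) →
             #occ a b s t ≡ #occ a b s′ t′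
  occ-cong a b s t s′ t′ L≡ same =
    ≤-antisym (occ-mono {a} {a} {b} {s} {s′} {t} {t′} to′)
              (occ-mono {a} {a} {b} {s′} {s} {t′} {t} from′)
    where
      to′ : ∀ {a b p} → Occurs a b s t p → Occurs a b s′ t′ p
      to′ {b = b} {p} (occurs a≤p fits sameₚ) =
        occurs a≤p (subst (λ L → p + L ≤ suc b) L≡ fits)
          (λ {m} m< → let m<L = subst (m <_) (sym L≡) m< in trans (sameₚ m<L) (same m<L))
      from′ : ∀ {a b p} → Occurs a b s′ t′ p → Occurs a b s t p
      from′ {b = b} {p} (occurs a≤p fits sameₚ) =
        occurs a≤p (subst (λ L → p + L ≤ suc b) (sym L≡) fits)
          (λ {m} m<L → trans (sameₚ (subst (m <_) L≡ m<L)) (sym (same m<L)))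

  occ-ε-≥2 : ∀ a b u v → a ≤ b → len u v ≡ 0 → 2 ≤ #occ a b u v
  occ-ε-≥2 a b u v a≤b ε =
    occ-≥2 (at-end a≤b (n≤1+n b)) (at-end (m≤n⇒m≤1+n a≤b) ≤-refl) (<⇒≢ ≤-refl)
    where
      at-end : ∀ {p} → a ≤ p → p ≤ suc b → Occurs a b u v p
      at-end {p} a≤p p≤b+1 = occurs a≤p
        (subst (λ L → p + L ≤ suc b) (sym ε) (≤-trans (≤-reflexive (+-identityʳ p)) p≤b+1))
        (λ {m} m<L → ⊥-elim (n≮0 (subst (m <_) ε m<L)))

  occ-≤-suc-narrow : ∀ a b s t → #occ a b s t ≤ suc (#occ (suc a) b s t)
  occ-≤-suc-narrow a b s t =
    countᵇ-≤-suc {f = occursᵇ a b s t} {g = occursᵇ (suc a) b s t} _ (upTo⁺ (suc (suc b)))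
    (occursᵇ-narrow {a} {b} {s} {t})

  occ-gain⇒Occurs : ∀ a b s t → #occ (suc a) b s t < #occ a b s t → Occurs a b s t a
  occ-gain⇒Occurs a b s t gain = occursᵇ⇒Occurs {a} {b} {s} {t}
    (countᵇ-gain {f = occursᵇ a b s t} {g = occursᵇ (suc a) b s t} (upTo (suc (suc b)))
      (occursᵇ-narrow {a} {b} {s} {t}) gain)

  IsSqp-shortest : ∀ {a b e E} → IsSqp _≟_ W a b e → a ≤ E → QuasiUnique _≟_ W a b a E → e ≤ E
  IsSqp-shortest {e = e} {E} (_ , _ , _ , shortest) a≤E quasi with e ≤? E
  ... | yes e≤E = e≤E
  ... | no  e≰E = ⊥-elim (shortest E a≤E (≰⇒> e≰E) quasi)

  -- The occurrence of w = T[u..v] lost by narrowing the window is at a, so w is a prefix of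
  -- T[a..b] occurring exactly twice.
  sqp-prefixOf-lostRepeat : ∀ {a b e} u v → suc a ≤ b →
    2 ≤ #occ a b u v → #occ (suc a) b u v ≤ 1 → IsSqp _≟_ W a b e →
    #occ a b a e ≡ 2 × len a e ≤ len u v × SameFactor a u (len a e)
  sqp-prefixOf-lostRepeat {a} {b} {e} u v a<b repeats ¬repeats sqp@(_ , _ , (_ , e-quasi) , _) =
    twice , e≤w , λ m< → w-at-a (<-≤-trans m< e≤w)
    where
      L = len u v
      instance
        nonempty : NonZero L
        nonempty = ≢-nonZero λ L≡0 → <⇒≱ (occ-ε-≥2 (suc a) b u v a<b L≡0) ¬repeats
      E = a + pred L
      atMostTwice : #occ a b u v ≤ 2
      atMostTwice = ≤-trans (occ-≤-suc-narrow a b u v) (s≤s ¬repeats)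
      w-at-a : SameFactor a u L
      w-at-a = Occurs.same (occ-gain⇒Occurs a b u v (≤-trans (s≤s ¬repeats) repeats))
      prefix≡w : #occ a b a E ≡ #occ a b u v
      prefix≡w = occ-cong a b a E u v (len-pred a L)
        (subst (SameFactor a u) (sym (len-pred a L)) w-at-a)
      prefix-quasiUnique : QuasiUnique _≟_ W a b a E
      prefix-quasiUnique = subst (1 ≤_) (sym prefix≡w) (≤-trans (s≤s z≤n) repeats)
                         , subst (_≤ 2) (sym prefix≡w) atMostTwice
      e≤w : len a e ≤ L
      e≤w = subst (len a e ≤_) (len-pred a L)
        (∸-monoˡ-≤ a (s≤s (IsSqp-shortest sqp (m≤m+n a (pred L)) prefix-quasiUnique)))
      twice : #occ a b a e ≡ 2
      twice = ≤-antisym e-quasi (begin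
        2             ≤⟨ repeats ⟩
        #occ a b u v  ≡⟨ prefix≡w ⟨
        #occ a b a E  ≤⟨ occ-prefix a b a E e (subst (len a e ≤_) (sym (len-pred a L)) e≤w) ⟩
        #occ a b a e  ∎)
        where open ≤-Reasoning

  ProperSubinterval⇒ProperSubstring : ∀ a e {u v s t} → ProperSubinterval u v s t →
    len a e ≤ len u v → SameFactor a u (len a e) → ProperSubstring _≟_ W a e s t
  ProperSubinterval⇒ProperSubstring a e {u} {s = s} {t} (s≤u , fits , shorter) e≤w same =
    occ-≥1 {s} {t} {a} {e} (occurs s≤u (≤-trans (+-monoʳ-≤ u e≤w) fits) (sym ∘ same))
    , ≤-<-trans e≤w shorter

  InMUS-narrow-unique : ∀ {a b s t} → InMUS _≟_ W a b s t → a < s → #occ (suc a) b s t ≡ 1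
  InMUS-narrow-unique {a} {b} {s} {t} (_ , s≤t , t≤b , unique , _) a<s = ≤-antisym
    (subst (#occ (suc a) b s t ≤_) unique (occ-narrow a b s t))
    (occ-≥1 (Occurs-self a<s (m≤n⇒m≤1+n s≤t) t≤b))

  ¬InMUS⇒nonrepeating-child : ∀ {a b s t} → a ≤ s → s ≤ t → t ≤ b → #occ a b s t ≡ 1 →
    ¬ InMUS _≟_ W a b s t → #occ a b (suc s) t ≤ 1 ⊎ #occ a b s (t ∸ 1) ≤ 1
  ¬InMUS⇒nonrepeating-child {a} {b} {s} {t} a≤s s≤t t≤b unique ¬mus
    with 2 ≤? #occ a b (suc s) t | 2 ≤? #occ a b s (t ∸ 1)
  ... | yes repeats₁ | yes repeats₂ = ⊥-elim (¬mus (a≤s , s≤t , t≤b , unique , repeats₁ , repeats₂))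
  ... | no ¬repeats₁ | _            = inj₁ (≤-pred (≰⇒> ¬repeats₁))
  ... | yes _        | no ¬repeats₂ = inj₂ (≤-pred (≰⇒> ¬repeats₂))

lemma18 : {A : Set} (_≟_ : DecidableEquality A) (n : ℕ) (T : Vec A n) (i j : ℕ) →
    1 < i → i ≤ j → j ≤ n →
    (s t : ℕ) → InMUS _≟_ T (i ∸ 1) j s t → s ≢ i ∸ 1 →
    ¬ InMUS _≟_ T i j s t →
    (e : ℕ) → IsSqp _≟_ T (i ∸ 1) j e →
    occ _≟_ T (i ∸ 1) j (i ∸ 1) e ≡ 2 × ProperSubstring _≟_ T (i ∸ 1) e s t
lemma18 _≟_ _ W (suc a) j _ a<j _ s t mus@(a≤s , s≤t , t≤j , _ , repeats₁ , repeats₂)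
        s≢a ¬mus e sqp =
  [ conclude (dropFirst-proper s≤t) repeats₁ , conclude (dropLast-proper 1≤t s≤t) repeats₂ ]′
    (¬InMUS⇒nonrepeating-child a<s s≤t t≤j (InMUS-narrow-unique mus a<s) ¬mus)
  where
    open Text _≟_ W
    a<s : a < s
    a<s = ≤∧≢⇒< a≤s (s≢a ∘ sym)
    1≤t : 1 ≤ t
    1≤t = ≤-trans (≤-trans (s≤s z≤n) a<s) s≤t
    conclude : ∀ {u v} → ProperSubinterval u v s t → 2 ≤ #occ a j u v → #occ (suc a) j u v ≤ 1 →
               #occ a j a e ≡ 2 × ProperSubstring _≟_ W a e s t
    conclude {u} {v} within repeats ¬repeats =
      let (twice , shorter , same) = sqp-prefixOf-lostRepeat u v a<j repeats ¬repeats sqp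
      in twice , ProperSubinterval⇒ProperSubstring a e within shorter same
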